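{- Let $m\ge 1$ and $1\le i\le m+1$. If $w=D(w_1,\dots,w_{i-1},w_i,\varnothing,\dots,\varnothing)$ with $w_i\neq\varnothing$, then the first factor in the factorisation of $w$ into generators of the free monoid $(\mathcal D_m,*)$ is $D(w_1,\dots,w_{i-1},10^m,\varnothing,\dots,\varnothing)$.
   Context: An $m$-Dyck path of size $n$ is a word with $n$ letters $1$ (up steps $(+m,+m)$) and $mn$ letters $0$ (down steps $(+1,-1)$) whose lattice path from $(0,0)$ never goes strictly below the horizontal axis; $\mathcal D_m$ is the set of non-empty ones, $\varnothing$ is the empty path. $D(w_1,\dots,w_{m+1})$ denotes the path $1w_10\,w_20\cdots w_m0\,w_{m+1}$ for $m$-Dyck paths $w_j$ (possibly empty). For non-empty $w_1,w_2$, $w_1*w_2$ is obtained from $w_1$ by replacing its rightmost peak (the last occurrence of the factor $10^m$) by $w_2$. $(\mathcal D_m,*)$ is a free monoid with unit $10^m$, freely generated by the paths $D(u_1,\dots,u_{j-1},10^m,\varnothing,\dots,\varnothing)$ with $1\le j\le m+1$, $u_k\in\mathcal D_m\cup\{\varnothing\}$; every element thus has a unique factorisation as a product of generators. -}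

module Defs where

open import Data.Nat using (ℕ; zero; suc; _+_)
open import Data.Bool using (Bool; true; false; if_then_else_; _∧_; _∨_)
open import Data.List using (List; []; _∷_; _++_; replicate; drop; length)
open import Data.Vec using (Vec; []; _∷_; lookup)
open import Data.Fin using (Fin)
open import Data.Fin as F using ()
open import Data.Empty using (⊥)
open import Data.Unit using (⊤)
open import Data.Product using (Σ; ∃; _×_)
open import Relation.Binary.PropositionalEquality using (_≡_; _≢_)

-- Letters: 𝟏 (the letter 1, up step (+m,+m)) and 𝟎 (the letter 0, down step (+1,-1)).
data Letter : Set where
  𝟏 𝟎 : Letter

Word : Set
Word = List Letter

ValidFrom : ℕ → ℕ → Word → Set
ValidFrom m zero    []      = ⊤
ValidFrom m (suc h) []      = ⊥
ValidFrom m h       (𝟏 ∷ w) = ValidFrom m (h + m) w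
ValidFrom m zero    (𝟎 ∷ w) = ⊥
ValidFrom m (suc h) (𝟎 ∷ w) = ValidFrom m h w

-- w is an m-Dyck path (possibly empty), i.e. w ∈ 𝒟_m ∪ {∅}.
-- (Ending at height 0 with heights ≥ 0 is equivalent to n letters 1, mn letters 0.)
IsDyck : ℕ → Word → Set
IsDyck m w = ValidFrom m 0 w

peak : ℕ → Word
peak m = 𝟏 ∷ replicate m 𝟎

Dtail : {k : ℕ} → Vec Word (suc k) → Word
Dtail (w ∷ [])       = w
Dtail (w ∷ w' ∷ ws)  = w ++ 𝟎 ∷ Dtail (w' ∷ ws)

D : {k : ℕ} → Vec Word (suc k) → Word
D ws = 𝟏 ∷ Dtail ws

eqL : Letter → Letter → Bool
eqL 𝟏 𝟏 = true
eqL 𝟎 𝟎 = true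
eqL _ _ = false

isPrefix : Word → Word → Bool
isPrefix []      _       = true
isPrefix (x ∷ p) []      = false
isPrefix (x ∷ p) (y ∷ w) = eqL x y ∧ isPrefix p w

hasFactor : Word → Word → Bool
hasFactor p []      = isPrefix p []
hasFactor p (x ∷ w) = isPrefix p (x ∷ w) ∨ hasFactor p w

replaceLast : Word → Word → Word → Word
replaceLast p []      v = []
replaceLast p (x ∷ w) v =
  if hasFactor p w then x ∷ replaceLast p w v
  else (if isPrefix p (x ∷ w) then v ++ drop (length p) (x ∷ w) else x ∷ w)

star : ℕ → Word → Word → Word
star m w₁ w₂ = replaceLast (peak m) w₁ w₂

prod : ℕ → List Word → Word
prod m []       = peak m
prod m (g ∷ gs) = star m g (prod m gs)

-- generators D(u₁,…,u_{j-1},10^m,∅,…,∅), 1 ≤ j ≤ m+1, u_k ∈ 𝒟_m ∪ {∅}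
-- (j is 0-indexed as an element of Fin (suc m))
IsGenerator : ℕ → Word → Set
IsGenerator m g =
  Σ (Vec Word (suc m)) λ us → Σ (Fin (suc m)) λ j →
    (lookup us j ≡ peak m)
    × ((k : Fin (suc m)) → k F.< j → IsDyck m (lookup us k))
    × ((k : Fin (suc m)) → j F.< k → lookup us k ≡ [])
    × (g ≡ D us)

data All′ (P : Word → Set) : List Word → Set where
  []  : All′ P []
  _∷_ : ∀ {x xs} → P x → All′ P xs → All′ P (x ∷ xs)

IsFactorisation : ℕ → Word → List Word → Set
IsFactorisation m w gs = All′ (IsGenerator m) gs × (prod m gs ≡ w)

{-# OPTIONS --safe #-}
module Submission where

-- Multiplying a generator g = D(u₁,…,u_{j-1},10^m,∅,…,∅) on the right by a
-- non-empty path P just substitutes P for the peak, g * P = D(u₁,…,u_{j-1},P,∅,…,∅).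
-- A path determines its D-decomposition (component k ends at the first return below the
-- level it started from), so from g * P = D(w₁,…,w_i,∅,…,∅) we read off u_k = w_k for
-- k < j, P = w_j and j = i: the last non-empty slot on each side must be the same one.
-- The empty factorisation is excluded because 10^m = D(∅,…,∅) while w_i ≠ ∅.

open import Defs
open import Data.Nat using (ℕ; zero; suc; _≥_; _+_; z<s; s<s)
open import Data.Nat.Properties using (+-assoc; +-comm)
open import Data.Bool using (true; false)
open import Data.Bool.Properties using (∨-zeroʳ)
open import Data.Fin using (Fin)
open import Data.Fin as F using ()
open import Data.Fin.Properties using (<-cmp; <⇒≢)
open import Data.List using (List; []; _∷_; _++_; replicate; drop; length)
open import Data.List.Properties using (++-assoc; ++-identityʳ; ∷-injectiveʳ)
open import Data.Vec using (Vec; lookup; _[_]≔_) renaming ([] to []ᵥ; _∷_ to _∷ᵥ_)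
import Data.Vec as Vec
open import Data.Vec.Properties
  using (lookup∘update; lookup∘update′; []≔-idempotent; []≔-lookup; lookup-replicate)
open import Data.Product using (Σ; _×_; _,_)
open import Data.Empty using (⊥-elim)
open import Data.Unit using (tt)
open import Relation.Binary using (tri<; tri≈; tri>)
open import Relation.Binary.PropositionalEquality
  using (_≡_; _≢_; refl; sym; trans; cong; cong₂; subst; module ≡-Reasoning)

AllDyck : ℕ → {k : ℕ} → Vec Word k → Set
AllDyck m {k} vs = (x : Fin k) → IsDyck m (lookup vs x)

allDyck-split : ∀ m {k} (vs : Vec Word (suc k)) (j : Fin (suc k))
  → ((x : Fin (suc k)) → x F.< j → IsDyck m (lookup vs x))
  → IsDyck m (lookup vs j)
  → ((x : Fin (suc k)) → j F.< x → lookup vs x ≡ [])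
  → AllDyck m vs
allDyck-split m vs j below at above x with <-cmp x j
... | tri< x<j _ _  = below x x<j
... | tri≈ _ refl _ = at
... | tri> _ _ j<x  = subst (IsDyck m) (sym (above x j<x)) tt

allDyck-update : ∀ m {k} (us : Vec Word (suc k)) (j : Fin (suc k))
  → ((x : Fin (suc k)) → x F.< j → IsDyck m (lookup us x))
  → ((x : Fin (suc k)) → j F.< x → lookup us x ≡ [])
  → ∀ P → IsDyck m P → AllDyck m (us [ j ]≔ P)
allDyck-update m us j below above P dP =
  allDyck-split m (us [ j ]≔ P) j
    (λ x x<j → subst (IsDyck m) (sym (lookup∘update′ (<⇒≢ x<j) us P)) (below x x<j))
    (subst (IsDyck m) (sym (lookup∘update j us P)) dP)
    (λ x j<x → trans (lookup∘update′ (λ x≡j → <⇒≢ j<x (sym x≡j)) us P) (above x j<x))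

firstReturn : ℕ → ℕ → Word → Word × Word
firstReturn m d [] = [] , []
firstReturn m d (𝟏 ∷ w) with firstReturn m (d + m) w
... | a , b = 𝟏 ∷ a , b
firstReturn m zero    (𝟎 ∷ w) = [] , w
firstReturn m (suc d) (𝟎 ∷ w) with firstReturn m d w
... | a , b = 𝟎 ∷ a , b

firstReturn-++ : ∀ m d w r → ValidFrom m d w → firstReturn m d (w ++ 𝟎 ∷ r) ≡ (w , r)
firstReturn-++ m zero [] r _ = refl
firstReturn-++ m zero (𝟏 ∷ w) r v
  rewrite firstReturn-++ m (zero + m) w r v = refl
firstReturn-++ m (suc d) (𝟏 ∷ w) r v
  rewrite firstReturn-++ m (suc d + m) w r v = refl
firstReturn-++ m (suc d) (𝟎 ∷ w) r v
  rewrite firstReturn-++ m d w r v = refl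

++-𝟎-injective : ∀ m {a b r s} → IsDyck m a → IsDyck m b
  → a ++ 𝟎 ∷ r ≡ b ++ 𝟎 ∷ s → (a ≡ b) × (r ≡ s)
++-𝟎-injective m {a} {b} {r} {s} da db eq
  with trans (sym (firstReturn-++ m 0 a r da))
             (trans (cong (firstReturn m 0) eq) (firstReturn-++ m 0 b s db))
... | refl = refl , refl

Dtail-injective : ∀ m {k} (vs ws : Vec Word (suc k)) → AllDyck m vs → AllDyck m ws
  → Dtail vs ≡ Dtail ws → vs ≡ ws
Dtail-injective m (v ∷ᵥ []ᵥ) (w ∷ᵥ []ᵥ) _ _ refl = refl
Dtail-injective m (v ∷ᵥ v′ ∷ᵥ vs) (w ∷ᵥ w′ ∷ᵥ ws) dv dw eq
  with ++-𝟎-injective m (dv F.zero) (dw F.zero) eq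
... | refl , eq′ =
  cong (v ∷ᵥ_) (Dtail-injective m (v′ ∷ᵥ vs) (w′ ∷ᵥ ws)
                  (λ x → dv (F.suc x)) (λ x → dw (F.suc x)) eq′)

D-injective : ∀ m {k} (vs ws : Vec Word (suc k)) → AllDyck m vs → AllDyck m ws
  → D vs ≡ D ws → vs ≡ ws
D-injective m vs ws dv dw eq = Dtail-injective m vs ws dv dw (∷-injectiveʳ eq)

ValidFrom-𝟏 : ∀ m h w → ValidFrom m (h + m) w → ValidFrom m h (𝟏 ∷ w)
ValidFrom-𝟏 m zero    w v = v
ValidFrom-𝟏 m (suc h) w v = v

ValidFrom-𝟏⁻ : ∀ m h w → ValidFrom m h (𝟏 ∷ w) → ValidFrom m (h + m) w
ValidFrom-𝟏⁻ m zero    w v = v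
ValidFrom-𝟏⁻ m (suc h) w v = v

ValidFrom-++ : ∀ m d h a b → ValidFrom m d a → ValidFrom m h b → ValidFrom m (d + h) (a ++ b)
ValidFrom-++ m zero    h []      b _  vb = vb
ValidFrom-++ m d       h (𝟏 ∷ a) b va vb =
  ValidFrom-𝟏 m (d + h) (a ++ b)
    (subst (λ e → ValidFrom m e (a ++ b)) reassoc
      (ValidFrom-++ m (d + m) h a b (ValidFrom-𝟏⁻ m d a va) vb))
  where
  open ≡-Reasoning
  reassoc : d + m + h ≡ d + h + m
  reassoc = begin
    d + m + h   ≡⟨ +-assoc d m h ⟩
    d + (m + h) ≡⟨ cong (d +_) (+-comm m h) ⟩
    d + (h + m) ≡⟨ sym (+-assoc d h m) ⟩
    d + h + m   ∎
ValidFrom-++ m (suc d) h (𝟎 ∷ a) b va vb = ValidFrom-++ m d h a b va vb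

Dtail-valid : ∀ m {k} (vs : Vec Word (suc k)) → AllDyck m vs → ValidFrom m k (Dtail vs)
Dtail-valid m (v ∷ᵥ []ᵥ) dv = dv F.zero
Dtail-valid m {suc k} (v ∷ᵥ v′ ∷ᵥ vs) dv =
  ValidFrom-++ m 0 (suc k) v _ (dv F.zero) (Dtail-valid m (v′ ∷ᵥ vs) (λ x → dv (F.suc x)))

ValidFrom-𝟎s : ∀ m n → ValidFrom m n (replicate n 𝟎)
ValidFrom-𝟎s m zero    = tt
ValidFrom-𝟎s m (suc n) = ValidFrom-𝟎s m n

Dtail-empty : ∀ {k} (vs : Vec Word (suc k)) → ((x : Fin (suc k)) → lookup vs x ≡ [])
  → Dtail vs ≡ replicate k 𝟎
Dtail-empty (v ∷ᵥ []ᵥ) e = e F.zero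
Dtail-empty (v ∷ᵥ v′ ∷ᵥ vs) e rewrite e F.zero =
  cong (𝟎 ∷_) (Dtail-empty (v′ ∷ᵥ vs) (λ x → e (F.suc x)))

peak≡D-empties : ∀ m → peak m ≡ D (Vec.replicate (suc m) [])
peak≡D-empties m = cong (𝟏 ∷_) (sym (Dtail-empty (Vec.replicate (suc m) []) (λ x → lookup-replicate x [])))

Dtail-cons : ∀ {k} u (vs : Vec Word (suc k)) → Dtail (u ∷ᵥ vs) ≡ u ++ 𝟎 ∷ Dtail vs
Dtail-cons u (v ∷ᵥ vs) = refl

Dtail-slot : ∀ m {k} (us : Vec Word (suc k)) (j : Fin (suc k)) → lookup us j ≡ peak m
  → ((x : Fin (suc k)) → j F.< x → lookup us x ≡ [])
  → Σ Word λ X → Σ ℕ λ t → (Dtail us ≡ X ++ peak m ++ replicate t 𝟎)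
                         × (∀ v → Dtail (us [ j ]≔ v) ≡ X ++ v ++ replicate t 𝟎)
Dtail-slot m (u ∷ᵥ []ᵥ) F.zero pk _ =
  [] , 0 , trans pk (sym (++-identityʳ _)) , λ v → sym (++-identityʳ v)
Dtail-slot m (u ∷ᵥ u′ ∷ᵥ us) F.zero pk above =
  [] , _ , cong₂ (λ a b → a ++ 𝟎 ∷ b) pk zeros , λ v → cong (λ b → v ++ 𝟎 ∷ b) zeros
  where zeros = Dtail-empty (u′ ∷ᵥ us) (λ x → above (F.suc x) z<s)
Dtail-slot m (u ∷ᵥ u′ ∷ᵥ us) (F.suc j) pk above
  with Dtail-slot m (u′ ∷ᵥ us) j pk (λ x j<x → above (F.suc x) (s<s j<x))
... | X , t , before , after =
  u ++ 𝟎 ∷ X , t ,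
  trans (cong (λ b → u ++ 𝟎 ∷ b) before) (sym (++-assoc u (𝟎 ∷ X) _)) ,
  λ v → trans (Dtail-cons u ((u′ ∷ᵥ us) [ j ]≔ v))
          (trans (cong (λ b → u ++ 𝟎 ∷ b) (after v)) (sym (++-assoc u (𝟎 ∷ X) _)))

isPrefix-++ : ∀ p b → isPrefix p (p ++ b) ≡ true
isPrefix-++ []      b = refl
isPrefix-++ (𝟏 ∷ p) b = isPrefix-++ p b
isPrefix-++ (𝟎 ∷ p) b = isPrefix-++ p b

hasFactor-++ : ∀ y q a b → hasFactor (y ∷ q) (a ++ (y ∷ q) ++ b) ≡ true
hasFactor-++ y q []      b rewrite isPrefix-++ (y ∷ q) b = refl
hasFactor-++ y q (x ∷ a) b rewrite hasFactor-++ y q a b = ∨-zeroʳ _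

hasFactor-𝟏-𝟎s : ∀ q a b → hasFactor (𝟏 ∷ q) (replicate a 𝟎 ++ replicate b 𝟎) ≡ false
hasFactor-𝟏-𝟎s q zero    zero    = refl
hasFactor-𝟏-𝟎s q zero    (suc b) = hasFactor-𝟏-𝟎s q zero b
hasFactor-𝟏-𝟎s q (suc a) b       = hasFactor-𝟏-𝟎s q a b

drop-length-++ : ∀ (p b : Word) → drop (length p) (p ++ b) ≡ b
drop-length-++ []      b = refl
drop-length-++ (x ∷ p) b = drop-length-++ p b

replaceLast-peak : ∀ m X t v
  → replaceLast (peak m) (X ++ peak m ++ replicate t 𝟎) v ≡ X ++ v ++ replicate t 𝟎
replaceLast-peak m [] t v
  rewrite hasFactor-𝟏-𝟎s (replicate m 𝟎) m t | isPrefix-++ (replicate m 𝟎) (replicate t 𝟎) =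
  cong (v ++_) (drop-length-++ (peak m) (replicate t 𝟎))
replaceLast-peak m (x ∷ X) t v rewrite hasFactor-++ 𝟏 (replicate m 𝟎) X (replicate t 𝟎) =
  cong (x ∷_) (replaceLast-peak m X t v)

star-generator : ∀ m {k} (us : Vec Word (suc k)) (j : Fin (suc k)) → lookup us j ≡ peak m
  → ((x : Fin (suc k)) → j F.< x → lookup us x ≡ [])
  → ∀ P → star m (D us) P ≡ D (us [ j ]≔ P)
star-generator m us j pk above P with Dtail-slot m us j pk above
... | X , t , before , after rewrite before | after P = replaceLast-peak m (𝟏 ∷ X) t P

prod-isDyck : ∀ m gs → All′ (IsGenerator m) gs → IsDyck m (prod m gs)
prod-isDyck m [] [] = ValidFrom-𝟎s m m
prod-isDyck m (_ ∷ gs) ((us , j , pk , below , above , refl) ∷ gens)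
  rewrite star-generator m us j pk above (prod m gs) =
  Dtail-valid m (us [ j ]≔ prod m gs)
    (allDyck-update m us j below above (prod m gs) (prod-isDyck m gs gens))

prod-≢-[] : ∀ m gs → All′ (IsGenerator m) gs → prod m gs ≢ []
prod-≢-[] m [] [] ()
prod-≢-[] m (_ ∷ gs) ((us , j , pk , _ , above , refl) ∷ _) eq
  with trans (sym (star-generator m us j pk above (prod m gs))) eq
... | ()

update-inverse : ∀ {A : Set} {k} (us ws : Vec A k) j {x y}
  → us [ j ]≔ y ≡ ws → lookup us j ≡ x → us ≡ ws [ j ]≔ x
update-inverse us ws j {x} {y} eq ux = begin
  us                       ≡⟨ sym ([]≔-lookup us j) ⟩
  us [ j ]≔ lookup us j    ≡⟨ cong (us [ j ]≔_) ux ⟩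
  us [ j ]≔ x              ≡⟨ sym ([]≔-idempotent us j) ⟩
  (us [ j ]≔ y) [ j ]≔ x   ≡⟨ cong (_[ j ]≔ x) eq ⟩
  ws [ j ]≔ x              ∎
  where open ≡-Reasoning

update-last-nonempty : ∀ {k} (us ws : Vec Word k) {i j : Fin k} {P : Word}
  → us [ j ]≔ P ≡ ws → P ≢ [] → ((x : Fin k) → j F.< x → lookup us x ≡ [])
  → lookup ws i ≢ [] → ((x : Fin k) → i F.< x → lookup ws x ≡ [])
  → j ≡ i
update-last-nonempty us ws {i} {j} {P} filled≡ws P≢[] us-above wi≢[] ws-above with <-cmp j i
... | tri< j<i _ _ = ⊥-elim (wi≢[] (begin
  lookup ws i              ≡⟨ cong (λ v → lookup v i) filled≡ws ⟨
  lookup (us [ j ]≔ P) i   ≡⟨ lookup∘update′ (λ i≡j → <⇒≢ j<i (sym i≡j)) us P ⟩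
  lookup us i              ≡⟨ us-above i j<i ⟩
  []                       ∎))
  where open ≡-Reasoning
... | tri≈ _ j≡i _ = j≡i
... | tri> _ _ i<j = ⊥-elim (P≢[] (begin
  P                        ≡⟨ lookup∘update j us P ⟨
  lookup (us [ j ]≔ P) j   ≡⟨ cong (λ v → lookup v j) filled≡ws ⟩
  lookup ws j              ≡⟨ ws-above j i<j ⟩
  []                       ∎))
  where open ≡-Reasoning

lemma2p3 : (m : ℕ) → m ≥ 1 → (i : Fin (suc m)) → (ws : Vec Word (suc m))
    → ((k : Fin (suc m)) → k F.< i → IsDyck m (lookup ws k))
    → IsDyck m (lookup ws i) → lookup ws i ≢ []
    → ((k : Fin (suc m)) → i F.< k → lookup ws k ≡ [])
    → (gs : List Word) → IsFactorisation m (D ws) gs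
    → Σ (List Word) λ rest → gs ≡ D (ws [ i ]≔ peak m) ∷ rest
lemma2p3 m _ i ws below at wi≢[] above [] ([] , peak≡) =
  ⊥-elim (wi≢[] (trans (cong (λ v → lookup v i) ws≡empties) (lookup-replicate i [])))
  where
  ws≡empties : ws ≡ Vec.replicate (suc m) []
  ws≡empties = D-injective m ws _ (allDyck-split m ws i below at above)
    (λ x → subst (IsDyck m) (sym (lookup-replicate x [])) tt)
    (trans (sym peak≡) (peak≡D-empties m))
lemma2p3 m _ i ws below at wi≢[] above (_ ∷ gs)
         ((us , j , pk , us-below , us-above , refl) ∷ gens , prod≡) =
  gs , cong (λ v → D v ∷ gs)
         (subst (λ j → us ≡ ws [ j ]≔ peak m) j≡i (update-inverse us ws j filled≡ws pk))
  where
  P = prod m gs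

  filled≡ws : us [ j ]≔ P ≡ ws
  filled≡ws = D-injective m _ ws
    (allDyck-update m us j us-below us-above P (prod-isDyck m gs gens))
    (allDyck-split m ws i below at above)
    (trans (sym (star-generator m us j pk us-above P)) prod≡)

  j≡i : j ≡ i
  j≡i = update-last-nonempty us ws filled≡ws (prod-≢-[] m gs gens) us-above wi≢[] above
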